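{- For every weakly acyclic expression $r$ over $\Sigma$, there is a weakly acyclic DFA that accepts the language $L(r)$.
   Context: Weakly acyclic expressions over a finite alphabet $\Sigma$ are generated by the grammar $r ::= \emptyset \mid \Gamma^* \mid \Lambda^* a\, r \mid r + r$, where $\Gamma,\Lambda\subseteq\Sigma$ and $a\in\Sigma\setminus\Lambda$, with the usual regular-expression semantics ($\Gamma^*$ is the set of all words over $\Gamma$, juxtaposition is concatenation, $+$ is union). A DFA $(Q,\Sigma,\delta,q_0,F)$ is weakly acyclic if for every $q\in Q$, nonempty word $w$ and letter $c$ occurring in $w$, $\delta(q,w)=q$ implies $\delta(q,c)=q$. -}

module Defs where

open import Data.Nat using (ℕ)
open import Data.Fin using (Fin)
open import Data.Fin.Subset using (Subset; _∈_; _∉_)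
open import Data.List using (List; []; _∷_; _++_; foldl)
open import Data.List.Relation.Unary.All using (All)
open import Data.List.Membership.Propositional using () renaming (_∈_ to _∈ₗ_)
open import Data.Product using (Σ; _×_; ∃-syntax)
open import Relation.Binary.PropositionalEquality using (_≡_; _≢_)
open import Function.Bundles using (_⇔_)

-- The finite alphabet Σ is Fin n; a subset Γ ⊆ Σ is a Data.Fin.Subset.
Word : ℕ → Set
Word n = List (Fin n)

-- Weakly acyclic expressions:  r ::= ∅ | Γ* | Λ* a r  (a ∉ Λ) | r + r
data WAExpr (n : ℕ) : Set where
  ∅ₑ   : WAExpr n
  star : Subset n → WAExpr n
  pre  : (Λ : Subset n) (a : Fin n) → a ∉ Λ → WAExpr n → WAExpr n
  _⊕_  : WAExpr n → WAExpr n → WAExpr n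

data _∈L_ {n : ℕ} : Word n → WAExpr n → Set where
  in-star : ∀ {Γ w} → All (_∈ Γ) w → w ∈L star Γ
  in-pre  : ∀ {Λ a a∉Λ r} u v → All (_∈ Λ) u → v ∈L r →
            (u ++ a ∷ v) ∈L pre Λ a a∉Λ r
  in-l    : ∀ {r s w} → w ∈L r → w ∈L (r ⊕ s)
  in-r    : ∀ {r s w} → w ∈L s → w ∈L (r ⊕ s)

record DFA (n : ℕ) : Set where
  field
    m  : ℕ
    δ  : Fin m → Fin n → Fin m
    q₀ : Fin m
    F  : Subset m

  δ* : Fin m → Word n → Fin m
  δ* = foldl δ

  Accepts : Word n → Set
  Accepts w = δ* q₀ w ∈ F

WeaklyAcyclic : ∀ {n} → DFA n → Set
WeaklyAcyclic {n} A = ∀ q (w : Word n) (c : Fin n) → w ≢ [] → c ∈ₗ w →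
                  δ* q w ≡ q → δ q c ≡ q
  where open DFA A

_accepts-L_ : ∀ {n} → DFA n → WAExpr n → Set
_accepts-L_ {n} A r = ∀ (w : Word n) → DFA.Accepts A w ⇔ (w ∈L r)

{-# OPTIONS --safe #-}
module Submission where

-- Build the automaton by structural recursion on r. Γ* is recognised by a start state
-- looping on Γ next to a sink; Λ* a r by a start state looping on Λ that enters the automaton
-- for r on a and the sink on every other letter; r + s by the product automaton. Weak
-- acyclicity is carried through the recursion in the stronger form of a ranking of the states
-- that strictly increases along every transition which is not a self-loop (ranks add up in the
-- product). Along a run that returns to its origin the rank cannot increase, so every step of
-- it is a self-loop at the origin.

open import Defs
open import Data.Nat using (ℕ; _+_; _*_; _≤_; _<_; z<s; s<s)
open import Data.Nat.Properties using (<⇒≤; ≤-refl; ≤-trans; <-≤-trans; <-irrefl; +-mono-<-≤; +-mono-≤-<)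
open import Data.Product using (Σ; ∃; _×_; _,_; proj₁; proj₂)
open import Data.Sum using (_⊎_; inj₁; inj₂)
import Data.Sum as Sum
open import Data.Sum.Function.Propositional using (_⊎-⇔_)
open import Data.Fin using (Fin; zero; suc; toℕ; combine; remQuot; _≟_)
open import Data.Fin.Properties using (remQuot-combine; combine-remQuot)
open import Data.Fin.Subset using (Subset; outside; _∈_; _∉_; ⊥; ⁅_⁆; _∪_)
open import Data.Fin.Subset.Properties using (_∈?_; ∉⊥; x∈⁅y⁆⇔x≡y; drop-there; ∪⇔⊎)
open import Data.List using ([]; _∷_; _++_; foldl)
open import Data.List.Properties using (foldl-++)
open import Data.List.Relation.Unary.All using (All; []; _∷_; universal)
import Data.List.Relation.Unary.All as All
open import Data.Vec using (_∷_; tabulate; lookup; there)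
open import Data.Vec.Properties using ([]=⇒lookup; lookup⇒[]=; lookup∘tabulate)
open import Function using (_∘_)
open import Function.Bundles using (_⇔_; mk⇔; Equivalence)
open import Function.Properties.Equivalence using () renaming (trans to ⇔-trans; sym to ⇔-sym)
open import Relation.Nullary using (yes; no; contradiction)
open import Relation.Binary.PropositionalEquality using (_≡_; refl; sym; trans; cong; cong₂; subst)
open import Relation.Binary.PropositionalEquality.Properties using (module ≡-Reasoning)

open Equivalence using (to; from)

module _ {S A : Set} (δ : S → A → S) where

  Loop : S → A → Set
  Loop q c = δ q c ≡ q

  foldl-loops : ∀ {q} w → All (Loop q) w → foldl δ q w ≡ q
  foldl-loops []      []       = refl
  foldl-loops (c ∷ w) (l ∷ ls) = trans (cong (λ p → foldl δ p w) l) (foldl-loops w ls)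

  Progressive : (S → ℕ) → Set
  Progressive rank = ∀ q c → Loop q c ⊎ rank q < rank (δ q c)

  module _ {rank : S → ℕ} (progressive : Progressive rank) where

    rank-step-mono : ∀ q c → rank q ≤ rank (δ q c)
    rank-step-mono q c with progressive q c
    ... | inj₁ loop = subst (λ p → rank q ≤ rank p) (sym loop) ≤-refl
    ... | inj₂ rank< = <⇒≤ rank<

    rank-foldl-mono : ∀ q w → rank q ≤ rank (foldl δ q w)
    rank-foldl-mono q []      = ≤-refl
    rank-foldl-mono q (c ∷ w) = ≤-trans (rank-step-mono q c) (rank-foldl-mono (δ q c) w)

    returning-run-loops : ∀ q w → foldl δ q w ≡ q → All (Loop q) w
    returning-run-loops q []      _      = []
    returning-run-loops q (c ∷ w) return with progressive q c
    ... | inj₁ loop = loop ∷ returning-run-loops q w (trans (cong (λ p → foldl δ p w) (sym loop)) return)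
    ... | inj₂ rank< = contradiction (<-≤-trans rank< (rank-foldl-mono (δ q c) w))
                                     (<-irrefl (cong rank (sym return)))

Ranked : ∀ {n} → DFA n → Set
Ranked D = ∃ (Progressive (DFA.δ D))

ranked⇒weaklyAcyclic : ∀ {n} (D : DFA n) → Ranked D → WeaklyAcyclic D
ranked⇒weaklyAcyclic D (_ , progressive) q w c _ c∈w return =
  All.lookup (returning-run-loops (DFA.δ D) progressive q w return) c∈w

preimage : ∀ {m k} → (Fin m → Fin k) → Subset k → Subset m
preimage f p = tabulate (lookup p ∘ f)

∈-preimage⇔ : ∀ {m k} {f : Fin m → Fin k} {p x} → x ∈ preimage f p ⇔ f x ∈ p
∈-preimage⇔ {f = f} {p} {x} = mk⇔
  (λ x∈ → lookup⇒[]= (f x) p (trans (sym (lookup∘tabulate (lookup p ∘ f) x)) ([]=⇒lookup x∈)))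
  (λ fx∈ → lookup⇒[]= x _ (trans (lookup∘tabulate (lookup p ∘ f) x) ([]=⇒lookup fx∈)))

∈L-pre-∷ : ∀ {n Λ a a∉Λ r c} {w : Word n} → c ∈ Λ → w ∈L pre Λ a a∉Λ r → (c ∷ w) ∈L pre Λ a a∉Λ r
∈L-pre-∷ c∈Λ (in-pre u v u∈Λ* v∈r) = in-pre (_ ∷ u) v (c∈Λ ∷ u∈Λ*) v∈r

∈L-⊕⇔ : ∀ {n r s} {w : Word n} → w ∈L (r ⊕ s) ⇔ (w ∈L r ⊎ w ∈L s)
∈L-⊕⇔ = mk⇔ (λ { (in-l w∈r) → inj₁ w∈r ; (in-r w∈s) → inj₂ w∈s }) Sum.[ in-l , in-r ]

pattern start   = zero
pattern sink    = suc zero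
pattern inner q = suc (suc q)

module EmptyDFA (n : ℕ) where

  D : DFA n
  D = record { m = 1 ; δ = λ q _ → q ; q₀ = start ; F = ⊥ }

  ranked : Ranked D
  ranked = (λ _ → 0) , λ _ _ → inj₁ refl

  accepts : D accepts-L ∅ₑ
  accepts w = mk⇔ (λ acc → contradiction acc ∉⊥) λ ()

module StarDFA {n} (Γ : Subset n) where

  δ : Fin 2 → Fin n → Fin 2
  δ start c with c ∈? Γ
  ... | yes _ = start
  ... | no _  = sink
  δ sink _ = sink

  D : DFA n
  D = record { m = 2 ; δ = δ ; q₀ = start ; F = ⁅ start ⁆ }

  start-loop⇔∈Γ : ∀ {c} → Loop δ start c ⇔ c ∈ Γ
  start-loop⇔∈Γ {c} with c ∈? Γ
  ... | yes c∈Γ = mk⇔ (λ _ → c∈Γ) (λ _ → refl)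
  ... | no c∉Γ  = mk⇔ (λ ()) (λ c∈Γ → contradiction c∈Γ c∉Γ)

  progressive : Progressive δ toℕ
  progressive start c with c ∈? Γ
  ... | yes _ = inj₁ refl
  ... | no _  = inj₂ z<s
  progressive sink _ = inj₁ refl

  ranked : Ranked D
  ranked = _ , progressive

  accepts : D accepts-L star Γ
  accepts w = mk⇔
    (λ acc → in-star (All.map (to start-loop⇔∈Γ)
                        (returning-run-loops δ progressive start w (to x∈⁅y⁆⇔x≡y acc))))
    (λ { (in-star w∈Γ*) → from x∈⁅y⁆⇔x≡y (foldl-loops δ w (All.map (from start-loop⇔∈Γ) w∈Γ*)) })

module PreDFA {n} (Λ : Subset n) (a : Fin n) (a∉Λ : a ∉ Λ) (B : DFA n) where
  open DFA B using () renaming (m to k; δ to δB; q₀ to q₀B; F to FB)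

  δ : Fin (2 + k) → Fin n → Fin (2 + k)
  δ start c with c ∈? Λ | c ≟ a
  ... | yes _ | _     = start
  ... | no _  | yes _ = inner q₀B
  ... | no _  | no _  = sink
  δ sink _ = sink
  δ (inner q) c = inner (δB q c)

  F : Subset (2 + k)
  F = outside ∷ outside ∷ FB

  D : DFA n
  D = record { m = 2 + k ; δ = δ ; q₀ = start ; F = F }

  start-loop : ∀ {c} → c ∈ Λ → Loop δ start c
  start-loop {c} c∈Λ with c ∈? Λ
  ... | yes _  = refl
  ... | no c∉Λ = contradiction c∈Λ c∉Λ

  start-a : δ start a ≡ inner q₀B
  start-a with a ∈? Λ | a ≟ a
  ... | yes a∈Λ | _     = contradiction a∈Λ a∉Λ
  ... | no _    | yes _ = refl
  ... | no _    | no a≢a = contradiction refl a≢a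

  foldl-inner : ∀ q w → foldl δ (inner q) w ≡ inner (foldl δB q w)
  foldl-inner q []      = refl
  foldl-inner q (c ∷ w) = foldl-inner (δB q c) w

  foldl-sink : ∀ w → foldl δ sink w ≡ sink
  foldl-sink w = foldl-loops δ w (universal (λ _ → refl) w)

  ranked : Ranked B → Ranked D
  ranked (rankB , progressiveB) = rank , progressive
    where
    rank : Fin (2 + k) → ℕ
    rank start     = 0
    rank sink      = 1
    rank (inner q) = 2 + rankB q

    progressive : Progressive δ rank
    progressive start c with c ∈? Λ | c ≟ a
    ... | yes _ | _     = inj₁ refl
    ... | no _  | yes _ = inj₂ z<s
    ... | no _  | no _  = inj₂ z<s
    progressive sink _ = inj₁ refl
    progressive (inner q) c = Sum.map (cong inner) (s<s ∘ s<s) (progressiveB q c)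

  module _ {r} (acceptsB : B accepts-L r) where

    accepted-from-start : ∀ w → foldl δ start w ∈ F → w ∈L pre Λ a a∉Λ r
    accepted-from-start [] ()
    accepted-from-start (c ∷ w) acc with c ∈? Λ | c ≟ a
    ... | yes c∈Λ | _ = ∈L-pre-∷ c∈Λ (accepted-from-start w acc)
    ... | no _ | yes refl =
      in-pre [] w [] (to (acceptsB w) (drop-there (drop-there (subst (_∈ F) (foldl-inner q₀B w) acc))))
    ... | no _ | no _ with there () ← subst (_∈ F) (foldl-sink w) acc

    foldl-start-pre : ∀ u v → All (_∈ Λ) u → foldl δ start (u ++ a ∷ v) ≡ inner (foldl δB q₀B v)
    foldl-start-pre u v u∈Λ* = begin
      foldl δ start (u ++ a ∷ v)         ≡⟨ foldl-++ δ start u (a ∷ v) ⟩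
      foldl δ (foldl δ start u) (a ∷ v)  ≡⟨ cong (λ q → foldl δ q (a ∷ v)) (foldl-loops δ u (All.map start-loop u∈Λ*)) ⟩
      foldl δ (δ start a) v              ≡⟨ cong (λ q → foldl δ q v) start-a ⟩
      foldl δ (inner q₀B) v              ≡⟨ foldl-inner q₀B v ⟩
      inner (foldl δB q₀B v)             ∎
      where open ≡-Reasoning

    accepts : D accepts-L pre Λ a a∉Λ r
    accepts w = mk⇔ (accepted-from-start w) λ where
      (in-pre u v u∈Λ* v∈r) →
        subst (_∈ F) (sym (foldl-start-pre u v u∈Λ*)) (there (there (from (acceptsB v) v∈r)))

module UnionDFA {n} (D₁ D₂ : DFA n) where
  open DFA D₁ using () renaming (m to m₁; δ to δ₁; q₀ to q₁; F to F₁)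
  open DFA D₂ using () renaming (m to m₂; δ to δ₂; q₀ to q₂; F to F₂)

  pair : Fin (m₁ * m₂) → Fin m₁ × Fin m₂
  pair = remQuot m₂

  δ : Fin (m₁ * m₂) → Fin n → Fin (m₁ * m₂)
  δ x c = combine (δ₁ (proj₁ (pair x)) c) (δ₂ (proj₂ (pair x)) c)

  F : Subset (m₁ * m₂)
  F = preimage (proj₁ ∘ pair) F₁ ∪ preimage (proj₂ ∘ pair) F₂

  D : DFA n
  D = record { m = m₁ * m₂ ; δ = δ ; q₀ = combine q₁ q₂ ; F = F }

  δ-combine : ∀ i j c → δ (combine i j) c ≡ combine (δ₁ i c) (δ₂ j c)
  δ-combine i j c = cong (λ (i′ , j′) → combine (δ₁ i′ c) (δ₂ j′ c)) (remQuot-combine i j)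

  foldl-combine : ∀ i j w → foldl δ (combine i j) w ≡ combine (foldl δ₁ i w) (foldl δ₂ j w)
  foldl-combine i j []      = refl
  foldl-combine i j (c ∷ w) = trans (cong (λ x → foldl δ x w) (δ-combine i j c))
                                    (foldl-combine (δ₁ i c) (δ₂ j c) w)

  ∈F⇔ : ∀ {x} → x ∈ F ⇔ (proj₁ (pair x) ∈ F₁ ⊎ proj₂ (pair x) ∈ F₂)
  ∈F⇔ = ⇔-trans ∪⇔⊎ (∈-preimage⇔ ⊎-⇔ ∈-preimage⇔)

  combine∈F⇔ : ∀ {i j} → combine i j ∈ F ⇔ (i ∈ F₁ ⊎ j ∈ F₂)
  combine∈F⇔ {i} {j} =
    subst (λ (i′ , j′) → combine i j ∈ F ⇔ (i′ ∈ F₁ ⊎ j′ ∈ F₂)) (remQuot-combine i j) ∈F⇔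

  ranked : Ranked D₁ → Ranked D₂ → Ranked D
  ranked (rank₁ , progressive₁) (rank₂ , progressive₂) = rank , progressive
    where
    rank : Fin (m₁ * m₂) → ℕ
    rank x = rank₁ (proj₁ (pair x)) + rank₂ (proj₂ (pair x))

    rank-combine : ∀ i j → rank (combine i j) ≡ rank₁ i + rank₂ j
    rank-combine i j = cong (λ (i′ , j′) → rank₁ i′ + rank₂ j′) (remQuot-combine i j)

    progressive-combine : ∀ i j c →
      δ (combine i j) c ≡ combine i j ⊎ rank (combine i j) < rank (δ (combine i j) c)
    progressive-combine i j c
      rewrite δ-combine i j c | rank-combine i j | rank-combine (δ₁ i c) (δ₂ j c)
      with progressive₁ i c | progressive₂ j c
    ... | inj₁ loop₁  | inj₁ loop₂  = inj₁ (cong₂ combine loop₁ loop₂)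
    ... | inj₂ rank₁< | _           = inj₂ (+-mono-<-≤ rank₁< (rank-step-mono δ₂ progressive₂ j c))
    ... | inj₁ _      | inj₂ rank₂< = inj₂ (+-mono-≤-< (rank-step-mono δ₁ progressive₁ i c) rank₂<)

    progressive : Progressive δ rank
    progressive x c = subst (λ y → Loop δ y c ⊎ rank y < rank (δ y c))
                            (combine-remQuot {m₁} m₂ x) (progressive-combine (proj₁ (pair x)) (proj₂ (pair x)) c)

  accepts⇔ : ∀ w → DFA.Accepts D w ⇔ (DFA.Accepts D₁ w ⊎ DFA.Accepts D₂ w)
  accepts⇔ w = subst (λ x → x ∈ F ⇔ (foldl δ₁ q₁ w ∈ F₁ ⊎ foldl δ₂ q₂ w ∈ F₂)) (sym (foldl-combine q₁ q₂ w)) combine∈F⇔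

  accepts : ∀ {r s} → D₁ accepts-L r → D₂ accepts-L s → D accepts-L (r ⊕ s)
  accepts accepts₁ accepts₂ w =
    ⇔-trans (accepts⇔ w) (⇔-trans (accepts₁ w ⊎-⇔ accepts₂ w) (⇔-sym ∈L-⊕⇔))

rankedDFA : ∀ {n} (r : WAExpr n) → Σ (DFA n) λ D → Ranked D × D accepts-L r
rankedDFA {n} ∅ₑ = D , ranked , accepts
  where open EmptyDFA n
rankedDFA (star Γ) = D , ranked , accepts
  where open StarDFA Γ
rankedDFA (pre Λ a a∉Λ r) =
  let B , rankedB , acceptsB = rankedDFA r
      open PreDFA Λ a a∉Λ B
  in D , ranked rankedB , accepts acceptsB
rankedDFA (r ⊕ s) =
  let D₁ , ranked₁ , accepts₁ = rankedDFA r
      D₂ , ranked₂ , accepts₂ = rankedDFA s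
      open UnionDFA D₁ D₂
  in D , ranked ranked₁ ranked₂ , accepts accepts₁ accepts₂

proposition13 : (n : ℕ) (r : WAExpr n) →
    Σ (DFA n) (λ A → WeaklyAcyclic A × A accepts-L r)
proposition13 n r =
  let D , ranked , accepts = rankedDFA r
  in D , ranked⇒weaklyAcyclic D ranked , accepts
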